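{- For every positive integer $n$, \[ D(n)\ \ge\ \max\{\ell_1(n),\ell_2(n),\ell_3(n)\}, \] where: $\ell_1(n)=T_k+(r-2)(k+2)+2$ if $n=T_k+r$ with integers $k\ge 1$, $2\le r\le k+1$, and $\ell_1(n)=-1$ if $n$ has no such representation; $\ell_2(n)=T_k+k(k-r-2)$ if $n=T_k+r$ with integers $k\ge 2$, $0\le r\le k-2$, and $\ell_2(n)=-1$ otherwise; $\ell_3(n)=T_{2r}+2r(r-1)$ if $n=T_{2r}+r$ for some integer $r\ge1$, and $\ell_3(n)=-1$ otherwise.
   Context: $T_j=j(j+1)/2$; the representations used in defining $\ell_1,\ell_2,\ell_3$ are unique when they exist. A mancala configuration is a map $\lambda:\mathbb N^*\to\mathbb N$ whose support $\{i:\lambda_i>0\}$ equals $\{1,\dots,\ell\}$ for some $\ell\ge0$; its mass is $\sum_i\lambda_i$ and $\Lambda_n$ denotes the set of those of mass $n$. The move $\Phi$: $\mu=\Phi(\lambda)$ with $\mu_i=\lambda_{i+1}+1$ for $1\le i\le\lambda_1$, $\mu_i=\lambda_{i+1}$ for $i>\lambda_1$. Componentwise order; $\lambda<\mu$ means $\lambda\le\mu$, $\lambda\ne\mu$. Marching group $M^k$: $M^k_i=k-i+1$ for $i\le k$, $0$ otherwise. An augmented marching group is a mancala configuration $\lambda$ with $M^k\le\lambda<M^{k+1}$ for some $k\ge0$. The depth of $\lambda$ is the least $t\ge0$ such that $\Phi^t(\lambda)$ is an augmented marching group; $D(n)$ is the maximal depth over $\Lambda_n$. -}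

module Defs where

open import Data.Nat using (ℕ; zero; suc; _+_; _*_; _∸_; _≤_; _<_)
open import Data.Nat.Properties
open import Data.List using (List; []; _∷_)
open import Data.Nat.ListAction using (sum)
open import Data.List.Relation.Unary.All using (All)
open import Data.Product using (Σ; ∃; _×_; _,_)
open import Relation.Nullary using (¬_)
open import Relation.Binary.PropositionalEquality using (_≡_)

T : ℕ → ℕ
T zero    = 0
T (suc j) = T j + suc j

-- A mancala configuration λ : ℕ* → ℕ with support {1,…,ℓ} is encoded as the
-- list [λ₁, …, λ_ℓ] of its nonzero values; all entries must be positive.
Config : Set
Config = List ℕ

IsMancala : Config → Set
IsMancala c = All (λ x → 1 ≤ x) c

-- the value λ_{i+1} of the map at position i+1 (zero outside the support)
at : Config → ℕ → ℕ
at []       _       = 0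
at (x ∷ xs) zero    = x
at (x ∷ xs) (suc i) = at xs i

mass : Config → ℕ
mass = sum

addOnes : ℕ → Config → Config
addOnes zero    xs       = xs
addOnes (suc a) []       = 1 ∷ addOnes a []
addOnes (suc a) (x ∷ xs) = suc x ∷ addOnes a xs

Φ : Config → Config
Φ []      = []
Φ (a ∷ c) = addOnes a c

Φ^ : ℕ → Config → Config
Φ^ zero    c = c
Φ^ (suc t) c = Φ (Φ^ t c)

_≼_ : Config → Config → Set
c ≼ μ = ∀ i → at c i ≤ at μ i

_≺_ : Config → Config → Set
c ≺ μ = (c ≼ μ) × ¬ (∀ i → at c i ≡ at μ i)

M : ℕ → Config
M zero    = []
M (suc k) = suc k ∷ M k

IsAMG : Config → Set
IsAMG c = ∃ λ k → (M k ≼ c) × (c ≺ M (suc k))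

IsDepth : Config → ℕ → Set
IsDepth c t = IsAMG (Φ^ t c) × (∀ s → s < t → ¬ IsAMG (Φ^ s c))

DAtLeast : ℕ → ℕ → Set
DAtLeast n ℓ = ∃ λ cfg → IsMancala cfg × mass cfg ≡ n × Σ ℕ (λ t → IsDepth cfg t × ℓ ≤ t)

-- Each bound is witnessed by an explicit configuration whose orbit under Φ is computed exactly.
-- A configuration has shape (k , w) when λ_{i+1} = (k ∸ i) + w_i for a word w of offsets in
-- {−1, …, +3}, padded with zeros; the marching group M^k is the shape (k , []). On shapes Φ acts
-- as a rotation of the word by one place together with a local rewrite at the foot of the
-- staircase. Starting from 1^{T_m} followed by a short word, the ones first pile up into the
-- staircase M^m in T_m steps; the short word then circulates until a configuration that is not an
-- augmented marching group becomes one in a single step. Since Φ preserves augmented marching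
-- groups, the number of steps taken is exactly the depth.

module Submission where

open import Defs
open import Data.Nat using (ℕ; zero; suc; pred; _+_; _*_; _∸_; _≤_; _<_; z≤n; s≤s; _≟_)
open import Data.Nat.Properties
open import Data.Nat.ListAction using (sum)
open import Data.Nat.ListAction.Properties using (sum-++)
open import Data.Nat.Tactic.RingSolver using (solve-∀)
open import Data.List using (List; []; _∷_; _++_; [_]; length; replicate; map)
open import Data.List.Properties using (++-assoc; ++-identityʳ; length-++; length-replicate; map-++; map-replicate)
open import Data.List.Relation.Unary.All as All using (All; []; _∷_)
open import Data.List.Relation.Unary.All.Properties using (++⁺; replicate⁺)
open import Data.Product using (∃₂; _×_; _,_; proj₁)
open import Data.Sum using (inj₁; inj₂)
open import Relation.Nullary using (¬_; yes; no)
open import Relation.Binary.PropositionalEquality using (_≡_; refl; sym; trans; cong; cong₂; subst; subst₂; module ≡-Reasoning)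

-- Φ and augmented marching groups

below : ℕ → ℕ → ℕ
below zero    _       = 0
below (suc a) zero    = 1
below (suc a) (suc i) = below a i

below-< : ∀ {a i} → i < a → below a i ≡ 1
below-< {suc a} {zero}  _         = refl
below-< {suc a} {suc i} (s≤s i<a) = below-< i<a

below-≥ : ∀ {a i} → a ≤ i → below a i ≡ 0
below-≥ {zero}            _         = refl
below-≥ {suc a} {suc i} (s≤s a≤i) = below-≥ a≤i

below-mono : ∀ {a b} i → a ≤ b → below a i ≤ below b i
below-mono         i       z≤n       = z≤n
below-mono {suc a} zero    (s≤s _)   = ≤-refl
below-mono {suc a} (suc i) (s≤s a≤b) = below-mono i a≤b

∸-suc+below : ∀ k i → k ∸ suc i + below k i ≡ k ∸ i
∸-suc+below zero    i       = sym (0∸n≡0 i)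
∸-suc+below (suc k) zero    = +-comm k 1
∸-suc+below (suc k) (suc i) = ∸-suc+below k i

at-addOnes : ∀ a xs i → at (addOnes a xs) i ≡ at xs i + below a i
at-addOnes zero    xs       i       = sym (+-identityʳ _)
at-addOnes (suc a) []       zero    = refl
at-addOnes (suc a) []       (suc i) = at-addOnes a [] i
at-addOnes (suc a) (x ∷ xs) zero    = +-comm 1 x
at-addOnes (suc a) (x ∷ xs) (suc i) = at-addOnes a xs i

at-Φ : ∀ c i → at (Φ c) i ≡ at c (suc i) + below (at c 0) i
at-Φ []      i = refl
at-Φ (a ∷ c) i = at-addOnes a c i

Φ^-Φ : ∀ n c → Φ^ n (Φ c) ≡ Φ (Φ^ n c)
Φ^-Φ zero    c = refl
Φ^-Φ (suc n) c = cong Φ (Φ^-Φ n c)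

Φ^-+ : ∀ m n c → Φ^ (m + n) c ≡ Φ^ n (Φ^ m c)
Φ^-+ zero    n c = refl
Φ^-+ (suc m) n c = trans (cong Φ (Φ^-+ m n c)) (sym (Φ^-Φ n (Φ^ m c)))

at-M : ∀ k i → at (M k) i ≡ k ∸ i
at-M zero    i       = sym (0∸n≡0 i)
at-M (suc k) zero    = refl
at-M (suc k) (suc i) = at-M k i

M≼⇒≤first : ∀ {k c} → M k ≼ c → k ≤ at c 0
M≼⇒≤first {k} lo = subst (_≤ _) (at-M k 0) (lo 0)

≼M⇒first≤ : ∀ {k c} → c ≼ M k → at c 0 ≤ k
≼M⇒first≤ {k} hi = subst (_ ≤_) (at-M k 0) (hi 0)

¬IsAMG-overflow : ∀ c k → at c 0 ≡ k → 1 ≤ at c (suc k) → ¬ IsAMG c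
¬IsAMG-overflow c k first≡k 1≤next (k′ , lo , hi , _) = <⇒≱ 1≤next (begin
  at c (suc k)        ≤⟨ hi (suc k) ⟩
  at (M (suc k′)) (suc k) ≡⟨ at-M (suc k′) (suc k) ⟩
  k′ ∸ k              ≡⟨ m≤n⇒m∸n≡0 (subst (_ ≤_) first≡k (M≼⇒≤first {k′} {c} lo)) ⟩
  0                   ∎)
  where open ≤-Reasoning

¬IsAMG-crossing : ∀ c k i j → at c i < at (M k) i → at (M k) j < at c j → ¬ IsAMG c
¬IsAMG-crossing c k i j ci<Mi Mj<cj (k′ , lo , hi , _) with k ≤? k′
... | yes k≤k′ = <⇒≱ ci<Mi (begin
  at (M k) i  ≡⟨ at-M k i ⟩
  k ∸ i       ≤⟨ ∸-monoˡ-≤ i k≤k′ ⟩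
  k′ ∸ i      ≡⟨ at-M k′ i ⟨
  at (M k′) i ≤⟨ lo i ⟩
  at c i      ∎)
  where open ≤-Reasoning
... | no k≰k′ = <⇒≱ Mj<cj (begin
  at c j            ≤⟨ hi j ⟩
  at (M (suc k′)) j ≡⟨ at-M (suc k′) j ⟩
  suc k′ ∸ j        ≤⟨ ∸-monoˡ-≤ j (≰⇒> k≰k′) ⟩
  k ∸ j             ≡⟨ at-M k j ⟨
  at (M k) j        ∎)
  where open ≤-Reasoning

Φ-preserves-M≼ : ∀ {k c} → M k ≼ c → M k ≼ Φ c
Φ-preserves-M≼ {k} {c} lo i = begin
  at (M k) i                       ≡⟨ at-M k i ⟩
  k ∸ i                            ≡⟨ ∸-suc+below k i ⟨
  k ∸ suc i + below k i            ≤⟨ +-mono-≤ (subst (_≤ _) (at-M k (suc i)) (lo (suc i)))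
                                                (below-mono i (M≼⇒≤first {k} {c} lo)) ⟩
  at c (suc i) + below (at c 0) i  ≡⟨ at-Φ c i ⟨
  at (Φ c) i                       ∎
  where open ≤-Reasoning

Φ-preserves-≼M : ∀ {k c} → c ≼ M k → Φ c ≼ M k
Φ-preserves-≼M {k} {c} hi i = begin
  at (Φ c) i                       ≡⟨ at-Φ c i ⟩
  at c (suc i) + below (at c 0) i  ≤⟨ +-mono-≤ (subst (_ ≤_) (at-M k (suc i)) (hi (suc i)))
                                                (below-mono i (≼M⇒first≤ {k} {c} hi)) ⟩
  k ∸ suc i + below k i            ≡⟨ ∸-suc+below k i ⟩
  k ∸ i                            ≡⟨ at-M k i ⟨
  at (M k) i                       ∎
  where open ≤-Reasoning

Φ-≢M : ∀ {k c} → M k ≼ c → c ≺ M (suc k) → ¬ (∀ i → at (Φ c) i ≡ at (M (suc k)) i)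
Φ-≢M {k} {c} lo (hi , c≢M) Φc≡M with at c 0 ≟ suc k
... | yes first≡ = c≢M c≡M
  where
    open ≡-Reasoning
    c≡M : ∀ i → at c i ≡ at (M (suc k)) i
    c≡M zero    = trans first≡ (sym (at-M (suc k) 0))
    c≡M (suc i) = trans (+-cancelʳ-≡ (below (suc k) i) _ _ (begin
      at c (suc i) + below (suc k) i      ≡⟨ cong (λ a → at c (suc i) + below a i) first≡ ⟨
      at c (suc i) + below (at c 0) i     ≡⟨ at-Φ c i ⟨
      at (Φ c) i                          ≡⟨ Φc≡M i ⟩
      at (M (suc k)) i                    ≡⟨ at-M (suc k) i ⟩
      suc k ∸ i                           ≡⟨ ∸-suc+below (suc k) i ⟨
      k ∸ i + below (suc k) i             ∎)) (sym (at-M k i))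
... | no first≢ = 1+n≰n (begin
  1                                   ≡⟨ m+n∸n≡m 1 k ⟨
  suc k ∸ k                           ≡⟨ at-M (suc k) k ⟨
  at (M (suc k)) k                    ≡⟨ Φc≡M k ⟨
  at (Φ c) k                          ≡⟨ at-Φ c k ⟩
  at c (suc k) + below (at c 0) k     ≡⟨ cong (at c (suc k) +_) (below-≥ (≤-reflexive first≡k)) ⟩
  at c (suc k) + 0                    ≤⟨ +-monoˡ-≤ 0 (hi (suc k)) ⟩
  at (M (suc k)) (suc k) + 0          ≡⟨ cong (_+ 0) (trans (at-M k k) (n∸n≡0 k)) ⟩
  0                                   ∎)
  where
    open ≤-Reasoning
    first≡k : at c 0 ≡ k
    first≡k = ≤-antisym (≤-pred (≤∧≢⇒< (≼M⇒first≤ {suc k} {c} hi) first≢)) (M≼⇒≤first {k} {c} lo)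

IsAMG-Φ : ∀ c → IsAMG c → IsAMG (Φ c)
IsAMG-Φ c (k , lo , hi) = k , Φ-preserves-M≼ {k} {c} lo , Φ-preserves-≼M {suc k} {c} (proj₁ hi) , Φ-≢M {k} {c} lo hi

IsAMG-Φ^ : ∀ d s c → IsAMG (Φ^ s c) → IsAMG (Φ^ (d + s) c)
IsAMG-Φ^ zero    s c amg = amg
IsAMG-Φ^ (suc d) s c amg = IsAMG-Φ (Φ^ (d + s) c) (IsAMG-Φ^ d s c amg)

IsDepth-transition : ∀ c t → ¬ IsAMG (Φ^ t c) → IsAMG (Φ^ (suc t) c) → IsDepth c (suc t)
IsDepth-transition c t ¬amg amg = amg , λ s s<t amgₛ →
  ¬amg (subst (λ u → IsAMG (Φ^ u c)) (m∸n+n≡m (≤-pred s<t)) (IsAMG-Φ^ (t ∸ s) s c amgₛ))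

-- Shapes and their evolution

data Offset : Set where
  −1 +0 +1 +2 +3 : Offset

-- truncated at 0: raise −1 0 = 0
raise : Offset → ℕ → ℕ
raise −1 b = pred b
raise +0 b = b
raise +1 b = 1 + b
raise +2 b = 2 + b
raise +3 b = 3 + b

-- only ever applied to non-negative offsets; lower −1 is a junk value
lower : Offset → Offset
lower −1 = −1
lower +0 = −1
lower +1 = +0
lower +2 = +1
lower +3 = +2

data NonNegative : Offset → Set where
  +0 : NonNegative +0
  +1 : NonNegative +1
  +2 : NonNegative +2
  +3 : NonNegative +3

data Binary : Offset → Set where
  +0 : Binary +0
  +1 : Binary +1

data Positive : Offset → Set where
  +1 : Positive +1
  +2 : Positive +2
  +3 : Positive +3

Binary⇒NonNegative : ∀ {x} → Binary x → NonNegative x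
Binary⇒NonNegative +0 = +0
Binary⇒NonNegative +1 = +1

raise-+1 : ∀ x {b} → 1 ≤ b → raise x b + 1 ≡ raise x (suc b)
raise-+1 −1 {suc b} _ = +-comm b 1
raise-+1 +0 {suc b} _ = +-comm (1 + b) 1
raise-+1 +1 {suc b} _ = +-comm (2 + b) 1
raise-+1 +2 {suc b} _ = +-comm (3 + b) 1
raise-+1 +3 {suc b} _ = +-comm (4 + b) 1

raise-0+1 : ∀ {x} → NonNegative x → raise x 0 + 1 ≡ raise x 1
raise-0+1 +0 = refl
raise-0+1 +1 = refl
raise-0+1 +2 = refl
raise-0+1 +3 = refl

raise-suc : ∀ x b → raise x (suc b) ≡ b + raise x 1
raise-suc −1 b = sym (+-identityʳ b)
raise-suc +0 b = +-comm 1 b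
raise-suc +1 b = +-comm 2 b
raise-suc +2 b = +-comm 3 b
raise-suc +3 b = +-comm 4 b

offsetAt : List Offset → ℕ → Offset
offsetAt []      _       = +0
offsetAt (x ∷ w) zero    = x
offsetAt (x ∷ w) (suc i) = offsetAt w i

offsetAt-++ˡ : ∀ p q {i} → i < length p → offsetAt (p ++ q) i ≡ offsetAt p i
offsetAt-++ˡ (x ∷ p) q {zero}  _         = refl
offsetAt-++ˡ (x ∷ p) q {suc i} (s≤s i<p) = offsetAt-++ˡ p q i<p

offsetAt-++ʳ : ∀ p q j → offsetAt (p ++ q) (length p + j) ≡ offsetAt q j
offsetAt-++ʳ []      q j = refl
offsetAt-++ʳ (x ∷ p) q j = offsetAt-++ʳ p q j

All-offsetAt : ∀ {P : Offset → Set} {w} → P +0 → All P w → ∀ i → P (offsetAt w i)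
All-offsetAt p0 []         i       = p0
All-offsetAt p0 (px ∷ _)   zero    = px
All-offsetAt p0 (_ ∷ pxs)  (suc i) = All-offsetAt p0 pxs i

data Last (P : Offset → Set) : List Offset → Set where
  here  : ∀ {x} → P x → Last P [ x ]
  there : ∀ x {w} → Last P w → Last P (x ∷ w)

Last-++ : ∀ {P q} p → Last P q → Last P (p ++ q)
Last-++ []      l = l
Last-++ (x ∷ p) l = there x (Last-++ p l)

All⇒Last : ∀ {P x w} → All P (x ∷ w) → Last P (x ∷ w)
All⇒Last {w = []}    (px ∷ []) = here px
All⇒Last {w = y ∷ w} (_ ∷ pw)  = there _ (All⇒Last pw)

Last⇒∷ʳ : ∀ {P w} → Last P w → ∃₂ λ p y → w ≡ p ++ [ y ] × P y
Last⇒∷ʳ (here py)   = [] , _ , refl , py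
Last⇒∷ʳ (there x l) with Last⇒∷ʳ l
... | p , y , refl , py = x ∷ p , y , refl , py

length-∷ʳ : ∀ {A : Set} (w : List A) x → length (w ++ [ x ]) ≡ suc (length w)
length-∷ʳ []      x = refl
length-∷ʳ (_ ∷ w) x = cong suc (length-∷ʳ w x)

length-++-∷ʳ : ∀ {A : Set} {m} (u v : List A) x → length (u ++ v) ≡ m → length (u ++ v ++ [ x ]) ≡ suc m
length-++-∷ʳ u v x len = trans (cong length (sym (++-assoc u v [ x ]))) (trans (length-∷ʳ (u ++ v) x) (cong suc len))

Shape : Set
Shape = ℕ × List Offset

height : Shape → ℕ → ℕ
height (k , w) i = raise (offsetAt w i) (k ∸ i)

_Fits_ : Config → Shape → Set
c Fits s = ∀ i → at c i ≡ height s i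

record _⟶⟨_⟩_ (s : Shape) (t : ℕ) (s′ : Shape) : Set where
  constructor evolve
  field run : ∀ c → c Fits s → Φ^ t c Fits s′
open _⟶⟨_⟩_ public

infixr 4 _⨾_
_⨾_ : ∀ {s s′ s″ a b} → s ⟶⟨ a ⟩ s′ → s′ ⟶⟨ b ⟩ s″ → s ⟶⟨ a + b ⟩ s″
_⨾_ {s″ = s″} {a} {b} g h = evolve λ c fits →
  subst (_Fits s″) (sym (Φ^-+ a b c)) (run h _ (run g c fits))

same-heights : ∀ {s s′} → (∀ i → height s i ≡ height s′ i) → s ⟶⟨ 0 ⟩ s′
same-heights eq = evolve λ c fits i → trans (fits i) (eq i)

recast : ∀ {k k′ w₁ w₁′ t t′ w₂ w₂′} → w₁ ≡ w₁′ → t ≡ t′ → w₂ ≡ w₂′ →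
         (k , w₁) ⟶⟨ t ⟩ (k′ , w₂) → (k , w₁′) ⟶⟨ t′ ⟩ (k′ , w₂′)
recast refl refl refl g = g

below-+ : ∀ m a j → below (m + a) (m + j) ≡ below a j
below-+ zero    a j = refl
below-+ (suc m) a j = below-+ m a j

-- The first entry m + raise x 1 is sown over the following positions: m units restore the
-- staircase, the remaining raise x 1 land beyond it, which is what the tail condition records.
step : ∀ m x v v′ →
       (∀ {i} → i < m → offsetAt v′ i ≡ offsetAt v i) →
       (∀ j → raise (offsetAt v (m + j)) 0 + below (raise x 1) j ≡ raise (offsetAt v′ (m + j)) (1 ∸ j)) →
       (suc m , x ∷ v) ⟶⟨ 1 ⟩ (suc m , v′)
step m x v v′ front back = evolve fitsΦ
  where
    open ≡-Reasoning
    first : ∀ c → c Fits (suc m , x ∷ v) → at c 0 ≡ m + raise x 1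
    first c fits = trans (fits 0) (raise-suc x m)

    front-part : ∀ c → c Fits (suc m , x ∷ v) → ∀ {i} → i < m → at (Φ c) i ≡ height (suc m , v′) i
    front-part c fits {i} i<m = begin
      at (Φ c) i
        ≡⟨ at-Φ c i ⟩
      at c (suc i) + below (at c 0) i
        ≡⟨ cong₂ _+_ (fits (suc i)) (trans (cong (λ a → below a i) (first c fits)) (below-< (≤-trans i<m (m≤m+n m _)))) ⟩
      raise (offsetAt v i) (m ∸ i) + 1
        ≡⟨ raise-+1 (offsetAt v i) (m<n⇒0<n∸m i<m) ⟩
      raise (offsetAt v i) (suc (m ∸ i))
        ≡⟨ cong₂ raise (front i<m) (+-∸-assoc 1 (<⇒≤ i<m)) ⟨
      raise (offsetAt v′ i) (suc m ∸ i) ∎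

    back-part : ∀ c → c Fits (suc m , x ∷ v) → ∀ j → at (Φ c) (m + j) ≡ height (suc m , v′) (m + j)
    back-part c fits j = begin
      at (Φ c) (m + j)
        ≡⟨ at-Φ c (m + j) ⟩
      at c (suc (m + j)) + below (at c 0) (m + j)
        ≡⟨ cong₂ _+_ (fits (suc (m + j))) (cong (λ a → below a (m + j)) (first c fits)) ⟩
      raise y (m ∸ (m + j)) + below (m + raise x 1) (m + j)
        ≡⟨ cong₂ (λ b d → raise y b + d) (m≤n⇒m∸n≡0 (m≤m+n m j)) (below-+ m (raise x 1) j) ⟩
      raise y 0 + below (raise x 1) j
        ≡⟨ back j ⟩
      raise y′ (1 ∸ j)
        ≡⟨ cong (raise y′) (trans (cong (_∸ (m + j)) (+-comm 1 m)) ([m+n]∸[m+o]≡n∸o m 1 j)) ⟨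
      raise y′ (suc m ∸ (m + j)) ∎
      where
        y y′ : Offset
        y  = offsetAt v (m + j)
        y′ = offsetAt v′ (m + j)

    fitsΦ : ∀ c → c Fits (suc m , x ∷ v) → Φ c Fits (suc m , v′)
    fitsΦ c fits i with <-≤-connex i m
    ... | inj₁ i<m = front-part c fits i<m
    ... | inj₂ m≤i with m≤n⇒∃[o]m+o≡n m≤i
    ...   | j , refl = back-part c fits j

TailMove : Offset → List Offset → List Offset → Set
TailMove x q q′ = ∀ j → raise (offsetAt q j) 0 + below (raise x 1) j ≡ raise (offsetAt q′ j) (1 ∸ j)

step-++ : ∀ {m} x p q q′ → length p ≡ m → TailMove x q q′ → (suc m , x ∷ p ++ q) ⟶⟨ 1 ⟩ (suc m , p ++ q′)
step-++ x p q q′ refl tail = step (length p) x (p ++ q) (p ++ q′)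
  (λ i<p → trans (offsetAt-++ˡ p q′ i<p) (sym (offsetAt-++ˡ p q i<p)))
  (λ j → subst₂ (λ y y′ → raise y 0 + below (raise x 1) j ≡ raise y′ (1 ∸ j))
                (sym (offsetAt-++ʳ p q j)) (sym (offsetAt-++ʳ p q′ j)) (tail j))

drop-zero : ∀ {m} v → All NonNegative v → (suc m , +0 ∷ v) ⟶⟨ 1 ⟩ (suc m , v)
drop-zero {m} v nn = step m +0 v v (λ _ → refl) back
  where
    back : ∀ j → raise (offsetAt v (m + j)) 0 + below 1 j ≡ raise (offsetAt v (m + j)) (1 ∸ j)
    back zero    = raise-0+1 (All-offsetAt +0 nn (m + 0))
    back (suc j) = trans (+-identityʳ _) (cong (raise (offsetAt v (m + suc j))) (sym (0∸n≡0 j)))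

rotate-tail : ∀ {x y} → Binary x → NonNegative y → TailMove x [ y ] (y ∷ [ x ])
rotate-tail +0 ny zero          = raise-0+1 ny
rotate-tail +1 ny zero          = raise-0+1 ny
rotate-tail +0 _  (suc zero)    = refl
rotate-tail +1 _  (suc zero)    = refl
rotate-tail +0 _  (suc (suc j)) = refl
rotate-tail +1 _  (suc (suc j)) = refl

rotate-head : ∀ {m x} v → Binary x → length v ≡ suc m → Last NonNegative v →
              (suc m , x ∷ v) ⟶⟨ 1 ⟩ (suc m , v ++ [ x ])
rotate-head {x = x} v bx len last with Last⇒∷ʳ last
... | p , y , refl , ny with suc-injective (trans (sym (length-∷ʳ p y)) len)
...   | refl = recast refl refl (sym (++-assoc p [ y ] [ x ]))
                 (step-++ x p [ y ] (y ∷ [ x ]) refl (rotate-tail bx ny))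

rotate : ∀ {m y} u v → All Binary u → NonNegative y → length (u ++ v) ≡ suc m →
         (suc m , u ++ v ++ [ y ]) ⟶⟨ length u ⟩ (suc m , v ++ y ∷ u)
rotate         []      v []        ny len = same-heights λ _ → refl
rotate {m} {y} (x ∷ u) v (bx ∷ bu) ny len =
  rotate-head (u ++ v ++ [ y ]) bx len′ (Last-++ u (Last-++ v (here ny)))
  ⨾ recast (sym (++-assoc u (v ++ [ y ]) [ x ])) refl (++-assoc v [ y ] (x ∷ u))
      (rotate u (v ++ [ y ]) bu (Binary⇒NonNegative bx) len′)
  where
    len′ : length (u ++ v ++ [ y ]) ≡ suc m
    len′ = length-++-∷ʳ u v y (suc-injective len)

surge-tail : ∀ {y} → NonNegative y → TailMove +2 [ y ] (y ∷ +1 ∷ [ +1 ])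
surge-tail ny zero                = raise-0+1 ny
surge-tail _  (suc zero)          = refl
surge-tail _  (suc (suc zero))    = refl
surge-tail _  (suc (suc (suc j))) = refl

surge : ∀ {m} v → length v ≡ suc m → Last NonNegative v →
        (suc m , +2 ∷ v) ⟶⟨ 1 ⟩ (suc m , v ++ +1 ∷ [ +1 ])
surge v len last with Last⇒∷ʳ last
... | p , y , refl , ny with suc-injective (trans (sym (length-∷ʳ p y)) len)
...   | refl = recast refl refl (sym (++-assoc p [ y ] (+1 ∷ [ +1 ])))
                 (step-++ +2 p [ y ] (y ∷ +1 ∷ [ +1 ]) refl (surge-tail ny))

split : ∀ {m} p → length p ≡ m → (suc m , +1 ∷ p ++ +1 ∷ [ +1 ]) ⟶⟨ 1 ⟩ (suc m , p ++ +1 ∷ [ +2 ])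
split p len = step-++ +1 p (+1 ∷ [ +1 ]) (+1 ∷ [ +2 ]) len tail
  where
    tail : TailMove +1 (+1 ∷ [ +1 ]) (+1 ∷ [ +2 ])
    tail zero          = refl
    tail (suc zero)    = refl
    tail (suc (suc j)) = refl

lower-step : ∀ {m y} u z → length u ≡ m → Binary y →
             (suc m , −1 ∷ u ++ y ∷ z) ⟶⟨ 1 ⟩ (suc m , u ++ lower y ∷ z)
lower-step {y = y} u z len by = step-++ −1 u (y ∷ z) (lower y ∷ z) len (tail by)
  where
    tail : Binary y → TailMove −1 (y ∷ z) (lower y ∷ z)
    tail +0 zero    = refl
    tail +1 zero    = refl
    tail _  (suc j) = trans (+-identityʳ _) (cong (raise (offsetAt z j)) (sym (0∸n≡0 j)))

offsetAt-padded : ∀ w n i → offsetAt (w ++ replicate n +0) i ≡ offsetAt w i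
offsetAt-padded []      zero    i       = refl
offsetAt-padded []      (suc n) zero    = refl
offsetAt-padded []      (suc n) (suc i) = offsetAt-padded [] n i
offsetAt-padded (x ∷ w) n       zero    = refl
offsetAt-padded (x ∷ w) n       (suc i) = offsetAt-padded w n i

pad : ∀ {k} w n → (k , w) ⟶⟨ 0 ⟩ (k , w ++ replicate n +0)
pad {k} w n = same-heights λ i → cong (λ x → raise x (k ∸ i)) (sym (offsetAt-padded w n i))

absorb : ∀ {m} u → length u ≡ m → (suc m , −1 ∷ u ++ [ +0 ]) ⟶⟨ 1 ⟩ (suc m , u ++ −1 ∷ [ +0 ])
absorb u len = lower-step u [] len +0 ⨾ recast refl refl (++-assoc u [ −1 ] [ +0 ]) (pad (u ++ [ −1 ]) 1)

drop-zeros : ∀ {m} n w → All NonNegative w → (suc m , replicate n +0 ++ w) ⟶⟨ n ⟩ (suc m , w)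
drop-zeros zero    w nn = same-heights λ _ → refl
drop-zeros (suc n) w nn = drop-zero (replicate n +0 ++ w) (++⁺ (replicate⁺ n +0) nn) ⨾ drop-zeros n w nn

replicate-+ : ∀ {A : Set} m n (x : A) → replicate (m + n) x ≡ replicate m x ++ replicate n x
replicate-+ zero    n x = refl
replicate-+ (suc m) n x = cong (x ∷_) (replicate-+ m n x)

replicate-∷ʳ : ∀ {A : Set} n (x : A) → replicate n x ++ [ x ] ≡ replicate (suc n) x
replicate-∷ʳ zero    x = refl
replicate-∷ʳ (suc n) x = cong (x ∷_) (replicate-∷ʳ n x)

absorb-ones : ∀ m w i → height (m , replicate (suc m) +1 ++ w) i ≡ height (suc m , replicate (suc m) +0 ++ w) i
absorb-ones zero    w zero    = refl
absorb-ones zero    w (suc i) = cong (raise (offsetAt w i)) (sym (0∸n≡0 i))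
absorb-ones (suc m) w zero    = refl
absorb-ones (suc m) w (suc i) = absorb-ones m w i

lower-heights : ∀ w → All NonNegative w → ∀ i →
                height (length w , w) i ≡ height (suc (length w) , map lower w ++ [ −1 ]) i
lower-heights []      []        zero    = refl
lower-heights []      []        (suc i) = sym (0∸n≡0 i)
lower-heights (x ∷ w) (+0 ∷ nn) zero    = refl
lower-heights (x ∷ w) (+1 ∷ nn) zero    = refl
lower-heights (x ∷ w) (+2 ∷ nn) zero    = refl
lower-heights (x ∷ w) (+3 ∷ nn) zero    = refl
lower-heights (x ∷ w) (_ ∷ nn)  (suc i) = lower-heights w nn i

lower-base : ∀ {m} w → length w ≡ m → All NonNegative w → (m , w) ⟶⟨ 0 ⟩ (suc m , map lower w ++ [ −1 ])
lower-base w refl nn = same-heights (lower-heights w nn)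

build-staircase : ∀ n w → All NonNegative w → (0 , replicate (T n) +1 ++ w) ⟶⟨ T n ⟩ (n , w)
build-staircase zero    w nn = same-heights λ _ → refl
build-staircase (suc n) w nn =
  recast words refl refl
    (build-staircase n (replicate (suc n) +1 ++ w) (++⁺ (replicate⁺ (suc n) +1) nn)
     ⨾ same-heights (absorb-ones n w)
     ⨾ drop-zeros (suc n) w nn)
  where
    words : replicate (T n) +1 ++ replicate (suc n) +1 ++ w ≡ replicate (T n + suc n) +1 ++ w
    words = trans (sym (++-assoc (replicate (T n) +1) _ w)) (cong (_++ w) (sym (replicate-+ (T n) (suc n) +1)))

offsetAt-beyond : ∀ w {i} → length w ≤ i → offsetAt w i ≡ +0
offsetAt-beyond []      _         = refl
offsetAt-beyond (x ∷ w) (s≤s w≤i) = offsetAt-beyond w w≤i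

≤-raise-Binary : ∀ {x} b → Binary x → b ≤ raise x b
≤-raise-Binary b +0 = ≤-refl
≤-raise-Binary b +1 = n≤1+n b

raise-Binary-≤ : ∀ {x} b → Binary x → raise x b ≤ suc b
raise-Binary-≤ b +0 = n≤1+n b
raise-Binary-≤ b +1 = ≤-refl

IsAMG-leading-zero : ∀ {k w c} → All Binary w → length w ≤ k → c Fits (k , +0 ∷ w) → IsAMG c
IsAMG-leading-zero {k} {w} {c} bw len fits = k , M≼c , c≼M , c≢M
  where
    open ≤-Reasoning
    M≼c : M k ≼ c
    M≼c i = begin
      at (M k) i              ≡⟨ at-M k i ⟩
      k ∸ i                   ≤⟨ ≤-raise-Binary (k ∸ i) (All-offsetAt +0 (+0 ∷ bw) i) ⟩
      height (k , +0 ∷ w) i   ≡⟨ fits i ⟨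
      at c i                  ∎
    c≼M : c ≼ M (suc k)
    c≼M i with ≤-<-connex i k
    ... | inj₁ i≤k = begin
      at c i                  ≡⟨ fits i ⟩
      height (k , +0 ∷ w) i   ≤⟨ raise-Binary-≤ (k ∸ i) (All-offsetAt +0 (+0 ∷ bw) i) ⟩
      suc (k ∸ i)             ≡⟨ +-∸-assoc 1 i≤k ⟨
      suc k ∸ i               ≡⟨ at-M (suc k) i ⟨
      at (M (suc k)) i        ∎
    ... | inj₂ k<i = begin
      at c i                  ≡⟨ fits i ⟩
      height (k , +0 ∷ w) i   ≡⟨ cong (λ x → raise x (k ∸ i)) (offsetAt-beyond (+0 ∷ w) (≤-trans (s≤s len) k<i)) ⟩
      k ∸ i                   ≤⟨ ∸-monoˡ-≤ i (n≤1+n k) ⟩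
      suc k ∸ i               ≡⟨ at-M (suc k) i ⟨
      at (M (suc k)) i        ∎
    c≢M : ¬ (∀ i → at c i ≡ at (M (suc k)) i)
    c≢M eq = 1+n≢n (trans (sym (eq 0)) (fits 0))

IsAMG-ones : ∀ {k c} → c Fits (k , replicate (suc k) +1) → IsAMG c
IsAMG-ones {k} {c} fits = IsAMG-leading-zero {suc k} {replicate k +0 ++ []} {c} (++⁺ (replicate⁺ k +0) []) len fits′
  where
    fits′ : c Fits (suc k , replicate (suc k) +0 ++ [])
    fits′ i = trans (subst (λ w → at c i ≡ height (k , w) i) (sym (++-identityʳ (replicate (suc k) +1))) (fits i))
                    (absorb-ones k [] i)
    len : length (replicate k +0 ++ []) ≤ suc k
    len = ≤-trans (≤-reflexive (trans (cong length (++-identityʳ (replicate k +0))) (length-replicate k))) (n≤1+n k)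

initial : List Offset → Config
initial = map (λ x → raise x 0)

initial-fits : ∀ w → initial w Fits (0 , w)
initial-fits []      i       = sym (0∸n≡0 i)
initial-fits (x ∷ w) zero    = refl
initial-fits (x ∷ w) (suc i) = trans (initial-fits w i) (cong (raise (offsetAt w i)) (0∸n≡0 i))

IsMancala-initial : ∀ {w} → All Positive w → IsMancala (initial w)
IsMancala-initial []        = []
IsMancala-initial (+1 ∷ pw) = s≤s z≤n ∷ IsMancala-initial pw
IsMancala-initial (+2 ∷ pw) = s≤s z≤n ∷ IsMancala-initial pw
IsMancala-initial (+3 ∷ pw) = s≤s z≤n ∷ IsMancala-initial pw

mass-initial-++ : ∀ p q → mass (initial (p ++ q)) ≡ mass (initial p) + mass (initial q)
mass-initial-++ p q = trans (cong sum (map-++ _ p q)) (sum-++ (initial p) (initial q))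

mass-initial-replicate : ∀ n x → mass (initial (replicate n x)) ≡ n * raise x 0
mass-initial-replicate zero    x = refl
mass-initial-replicate (suc n) x = cong (raise x 0 +_) (mass-initial-replicate n x)

DAtLeast-witness : ∀ {w t s s′} → All Positive w → (0 , w) ⟶⟨ t ⟩ s → s ⟶⟨ 1 ⟩ s′ →
                   (∀ c → c Fits s → ¬ IsAMG c) → (∀ c → c Fits s′ → IsAMG c) →
                   DAtLeast (mass (initial w)) (suc t)
DAtLeast-witness {w} {t} {s} pw g h ¬amg amg =
  initial w , IsMancala-initial pw , refl , suc t ,
  IsDepth-transition (initial w) t (¬amg cₜ fitsₜ) (amg (Φ cₜ) (run h cₜ fitsₜ)) , ≤-refl
  where
    cₜ : Config
    cₜ = Φ^ t (initial w)
    fitsₜ : cₜ Fits s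
    fitsₜ = run g (initial w) (initial-fits w)

length-replicates : ∀ {A : Set} a b (x y : A) → length (replicate a x ++ replicate b y) ≡ a + b
length-replicates a b x y = trans (length-++ (replicate a x)) (cong₂ _+_ (length-replicate a) (length-replicate b))

All-zeros-ones : ∀ z b → All Binary (replicate z +0 ++ replicate b +1)
All-zeros-ones z b = ++⁺ (replicate⁺ z +0) (replicate⁺ b +1)

mass-initial-replicate-++ : ∀ n x w → mass (initial (replicate n x ++ w)) ≡ n * raise x 0 + mass (initial w)
mass-initial-replicate-++ n x w =
  trans (mass-initial-++ (replicate n x) w) (cong (_+ mass (initial w)) (mass-initial-replicate n x))

offsetAt-++-index : ∀ p q j {n} → length p ≡ n → offsetAt (p ++ q) (j + n) ≡ offsetAt q j
offsetAt-++-index p q j refl = trans (cong (offsetAt (p ++ q)) (+-comm j (length p))) (offsetAt-++ʳ p q j)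

M<Fits-+1 : ∀ {k w c} i → c Fits (k , w) → offsetAt w i ≡ +1 → at (M k) i < at c i
M<Fits-+1 {k} i fits one =
  subst₂ _<_ (sym (at-M k i)) (sym (trans (fits i) (cong (λ x → raise x (k ∸ i)) one))) ≤-refl

Fits-−1<M : ∀ {m w c} → c Fits (suc m , −1 ∷ w) → at c 0 < at (M (suc m)) 0
Fits-−1<M fits = subst (_< _) (sym (fits 0)) ≤-refl

IsAMG-zeros-ones : ∀ {k} z b c → z + b ≡ suc k → c Fits (k , replicate z +0 ++ replicate b +1) → IsAMG c
IsAMG-zeros-ones zero    b c refl fits = IsAMG-ones {c = c} fits
IsAMG-zeros-ones (suc z) b c len  fits =
  IsAMG-leading-zero {w = replicate z +0 ++ replicate b +1} {c} (All-zeros-ones z b)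
    (≤-reflexive (trans (length-replicates z b +0 +1) (suc-injective len))) fits

-- The first family

surge-split-rotate : ∀ {m} u v → All Binary u → length (u ++ v) ≡ m → Last NonNegative (+1 ∷ u ++ v) →
                     (suc m , +2 ∷ +1 ∷ u ++ v) ⟶⟨ 2 + length u ⟩ (suc m , v ++ +1 ∷ +2 ∷ u)
surge-split-rotate {m} u v bin len last =
  surge (+1 ∷ u ++ v) (cong suc len) last
  ⨾ split (u ++ v) len
  ⨾ recast (trans (cong (u ++_) (++-assoc v [ +1 ] [ +2 ])) (sym (++-assoc u v (+1 ∷ [ +2 ])))) refl
           (++-assoc v [ +1 ] (+2 ∷ u))
      (rotate u (v ++ [ +1 ]) bin +2 (length-++-∷ʳ u v +1 len))

two-cycle : ∀ {m} rest → All Binary rest → length rest ≡ m →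
            (suc m , +2 ∷ +1 ∷ rest) ⟶⟨ 3 + m ⟩ (suc m , +2 ∷ rest ++ [ +1 ])
two-cycle {m} rest bin len =
  recast (cong (λ w → +2 ∷ +1 ∷ w) (++-identityʳ rest)) (trans (cong (λ l → 2 + l + 1) len) (+-comm (2 + m) 1)) refl
    (surge-split-rotate rest [] bin (trans (cong length (++-identityʳ rest)) len) (All⇒Last (+1 ∷ ++⁺ nonneg []))
     ⨾ rotate-head (+2 ∷ rest) +1 (cong suc len) (All⇒Last (+2 ∷ nonneg)))
  where
    nonneg : All NonNegative rest
    nonneg = All.map Binary⇒NonNegative bin

two-cycles : ∀ {m} b rest → All Binary rest → b + length rest ≡ suc m →
             (suc m , +2 ∷ replicate b +1 ++ rest) ⟶⟨ b * (3 + m) ⟩ (suc m , +2 ∷ rest ++ replicate b +1)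
two-cycles zero    rest bin len = recast refl refl (cong (+2 ∷_) (sym (++-identityʳ rest))) (same-heights λ _ → refl)
two-cycles (suc b) rest bin len =
  two-cycle (replicate b +1 ++ rest) (++⁺ (replicate⁺ b +1) bin)
            (suc-injective (trans (cong suc (trans (length-++ (replicate b +1)) (cong (_+ length rest) (length-replicate b)))) len))
  ⨾ recast (cong (+2 ∷_) (sym (++-assoc (replicate b +1) rest [ +1 ]))) refl
           (cong (+2 ∷_) (++-assoc rest [ +1 ] (replicate b +1)))
      (two-cycles b (rest ++ [ +1 ]) (++⁺ bin (+1 ∷ [])) (trans (cong (b +_) (length-∷ʳ rest +1)) (trans (+-suc b (length rest)) len)))

ℓ₁-orbit : ∀ a z →
           (0 , replicate (T (suc (a + z))) +1 ++ +2 ∷ replicate a +1) ⟶⟨ T (suc (a + z)) + (a * (3 + (a + z)) + 1) ⟩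
           (suc (a + z) , +0 ∷ (replicate z +0 ++ replicate a +1) ++ +1 ∷ [ +1 ])
ℓ₁-orbit a z =
  build-staircase (suc (a + z)) (+2 ∷ replicate a +1) (+2 ∷ replicate⁺ a +1)
  ⨾ pad (+2 ∷ replicate a +1) (suc z)
  ⨾ two-cycles a (replicate (suc z) +0) (replicate⁺ (suc z) +0) (trans (cong (a +_) (length-replicate (suc z))) (+-suc a z))
  ⨾ surge (+0 ∷ replicate z +0 ++ replicate a +1) (cong suc (trans (length-replicates z a +0 +1) (+-comm z a)))
          (All⇒Last (+0 ∷ All.map Binary⇒NonNegative (All-zeros-ones z a)))

ℓ₁-witness : ∀ a z → DAtLeast (T (suc a + z) + (2 + a)) (T (suc a + z) + a * (suc a + z + 2) + 2)
ℓ₁-witness a z =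
  subst₂ DAtLeast mass≡ (arith-time (T k) a z)
    (DAtLeast-witness (++⁺ (replicate⁺ (T k) +1) (+2 ∷ replicate⁺ a +1)) (ℓ₁-orbit a z)
       (drop-zero (rest ++ +1 ∷ [ +1 ]) (++⁺ (All.map Binary⇒NonNegative (All-zeros-ones z a)) (+1 ∷ +1 ∷ [])))
       ¬amg amg)
  where
    arith-count : ∀ z a → z + (a + 2) ≡ suc (suc (a + z))
    arith-count = solve-∀
    arith-mass : ∀ x a → x * 1 + (2 + a * 1) ≡ x + (2 + a)
    arith-mass = solve-∀
    arith-time : ∀ x a z → suc (x + (a * (3 + (a + z)) + 1)) ≡ x + a * (suc (a + z) + 2) + 2
    arith-time = solve-∀
    k = suc (a + z)
    rest = replicate z +0 ++ replicate a +1
    ¬amg : ∀ c → c Fits (k , +0 ∷ rest ++ +1 ∷ [ +1 ]) → ¬ IsAMG c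
    ¬amg c fits = ¬IsAMG-overflow c k (fits 0)
      (≤-trans (s≤s z≤n) (M<Fits-+1 {k} {+0 ∷ rest ++ +1 ∷ [ +1 ]} {c} (suc k) fits
                            (offsetAt-++-index rest (+1 ∷ [ +1 ]) 1 (trans (length-replicates z a +0 +1) (+-comm z a)))))
    amg : ∀ c → c Fits (k , rest ++ +1 ∷ [ +1 ]) → IsAMG c
    amg c fits = IsAMG-zeros-ones {k} z (a + 2) c (arith-count z a) λ i →
      trans (fits i) (cong (λ w → height (k , w) i) (trans (++-assoc (replicate z +0) (replicate a +1) _)
                                                            (cong (replicate z +0 ++_) (sym (replicate-+ a 2 +1)))))
    mass≡ : mass (initial (replicate (T k) +1 ++ +2 ∷ replicate a +1)) ≡ T k + (2 + a)
    mass≡ = trans (mass-initial-replicate-++ (T k) +1 _)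
                  (trans (cong (λ y → T k * 1 + (2 + y)) (mass-initial-replicate a +1)) (arith-mass (T k) a))

-- The second family

zero-passes-minus : ∀ {m} u → All Binary u → length u ≡ m →
                    (suc (suc m) , u ++ +0 ∷ −1 ∷ [ +0 ]) ⟶⟨ suc (suc m) ⟩ (suc (suc m) , +0 ∷ u ++ −1 ∷ [ +0 ])
zero-passes-minus {m} u bin len =
  recast (++-assoc u [ +0 ] (−1 ∷ [ +0 ])) (trans (cong (_+ 1) len-u0) (+-comm (suc m) 1)) refl
    (rotate (u ++ [ +0 ]) [ −1 ] (++⁺ bin (+0 ∷ [])) +0 (trans (length-∷ʳ (u ++ [ +0 ]) −1) (cong suc len-u0))
     ⨾ absorb (+0 ∷ u) (cong suc len))
  where
    len-u0 : length (u ++ [ +0 ]) ≡ suc m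
    len-u0 = trans (length-∷ʳ u +0) (cong suc len)

zeros-pass-minus : ∀ {m} g x → All Binary x → length x + g ≡ suc m →
                   (suc (suc m) , x ++ replicate g +0 ++ −1 ∷ [ +0 ]) ⟶⟨ g * suc (suc m) ⟩
                   (suc (suc m) , replicate g +0 ++ x ++ −1 ∷ [ +0 ])
zeros-pass-minus zero    x bin len = same-heights λ _ → refl
zeros-pass-minus (suc g) x bin len =
  recast source refl refl (zero-passes-minus (x ++ replicate g +0) (++⁺ bin (replicate⁺ g +0)) len-u)
  ⨾ recast (sym (++-assoc (+0 ∷ x) (replicate g +0) _)) refl target
      (zeros-pass-minus g (+0 ∷ x) (+0 ∷ bin) (trans (sym (+-suc (length x) g)) len))
  where
    len-u : length (x ++ replicate g +0) ≡ _
    len-u = suc-injective (trans (cong suc (trans (length-++ x) (cong (length x +_) (length-replicate g))))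
                                 (trans (sym (+-suc (length x) g)) len))
    source : (x ++ replicate g +0) ++ +0 ∷ −1 ∷ [ +0 ] ≡ x ++ replicate (suc g) +0 ++ −1 ∷ [ +0 ]
    source = trans (++-assoc x (replicate g +0) _)
                   (cong (x ++_) (trans (sym (++-assoc (replicate g +0) [ +0 ] _)) (cong (_++ −1 ∷ [ +0 ]) (replicate-∷ʳ g +0))))
    target : replicate g +0 ++ (+0 ∷ x) ++ −1 ∷ [ +0 ] ≡ replicate (suc g) +0 ++ x ++ −1 ∷ [ +0 ]
    target = trans (sym (++-assoc (replicate g +0) [ +0 ] _)) (cong (_++ x ++ −1 ∷ [ +0 ]) (replicate-∷ʳ g +0))

ℓ₂-orbit : ∀ r g →
           (0 , replicate (T (suc (r + g))) +1 ++ replicate (suc r) +2 ++ replicate g +1)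
             ⟶⟨ T (suc (r + g)) + (g * (2 + (r + g)) + (g + suc r)) ⟩
           (2 + (r + g) , −1 ∷ +0 ∷ replicate g +0 ++ replicate (suc r) +1)
ℓ₂-orbit r g =
  recast refl (cong (λ l → T m + (g * suc m + l)) (length-replicates g (suc r) +0 +1)) refl
    (build-staircase m tail tail-nonneg
     ⨾ lower-base tail (length-replicates (suc r) g +2 +1) tail-nonneg
     ⨾ recast refl refl lowered (pad (map lower tail ++ [ −1 ]) 1)
     ⨾ zeros-pass-minus g ones (replicate⁺ (suc r) +1) (cong (_+ g) (length-replicate (suc r)))
     ⨾ recast (++-assoc (replicate g +0) ones (−1 ∷ [ +0 ])) refl refl
         (rotate (replicate g +0 ++ ones) [ −1 ] (All-zeros-ones g (suc r)) +0
                 (trans (length-∷ʳ (replicate g +0 ++ ones) −1) (cong suc (trans (length-replicates g (suc r) +0 +1) (arith g r))))))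
  where
    arith : ∀ g r → g + suc r ≡ suc (r + g)
    arith = solve-∀
    m = suc (r + g)
    tail = replicate (suc r) +2 ++ replicate g +1
    ones = replicate (suc r) +1
    tail-nonneg : All NonNegative tail
    tail-nonneg = ++⁺ (replicate⁺ (suc r) +2) (replicate⁺ g +1)
    lowered : (map lower tail ++ [ −1 ]) ++ replicate 1 +0 ≡ ones ++ replicate g +0 ++ −1 ∷ [ +0 ]
    lowered = begin
      (map lower tail ++ [ −1 ]) ++ [ +0 ]
        ≡⟨ cong (λ w → (w ++ [ −1 ]) ++ [ +0 ]) (map-++ lower (replicate (suc r) +2) (replicate g +1)) ⟩
      ((map lower (replicate (suc r) +2) ++ map lower (replicate g +1)) ++ [ −1 ]) ++ [ +0 ]
        ≡⟨ cong₂ (λ u v → ((u ++ v) ++ [ −1 ]) ++ [ +0 ]) (map-replicate lower (suc r) +2) (map-replicate lower g +1) ⟩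
      ((ones ++ replicate g +0) ++ [ −1 ]) ++ [ +0 ]
        ≡⟨ ++-assoc (ones ++ replicate g +0) [ −1 ] [ +0 ] ⟩
      (ones ++ replicate g +0) ++ [ −1 ] ++ [ +0 ]
        ≡⟨ ++-assoc ones (replicate g +0) (−1 ∷ [ +0 ]) ⟩
      ones ++ replicate g +0 ++ [ −1 ] ++ [ +0 ] ∎
      where open ≡-Reasoning

ℓ₂-witness : ∀ r g → DAtLeast (T (2 + (r + g)) + r) (T (2 + (r + g)) + (2 + (r + g)) * g)
ℓ₂-witness r g =
  subst₂ DAtLeast mass≡ (arith-time (T m) r g)
    (DAtLeast-witness (++⁺ (replicate⁺ (T m) +1) (++⁺ (replicate⁺ (suc r) +2) (replicate⁺ g +1))) (ℓ₂-orbit r g)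
       final-step ¬amg amg)
  where
    arith-mass : ∀ x r g → x * 1 + (suc r * 2 + g * 1) ≡ x + suc (suc (r + g)) + r
    arith-mass = solve-∀
    arith-time : ∀ x r g → suc (x + (g * suc (suc (r + g)) + (g + suc r))) ≡ x + suc (suc (r + g)) + suc (suc (r + g)) * g
    arith-time = solve-∀
    m = suc (r + g)
    k = suc m
    settled = replicate g +0 ++ replicate r +1
    final-step : (k , −1 ∷ +0 ∷ replicate g +0 ++ replicate (suc r) +1) ⟶⟨ 1 ⟩ (k , +0 ∷ settled ++ [ +0 ])
    final-step =
      recast (cong (λ w → −1 ∷ +0 ∷ w) (trans (++-assoc (replicate g +0) (replicate r +1) [ +1 ])
                                               (cong (replicate g +0 ++_) (replicate-∷ʳ r +1))))
             refl refl
        (lower-step (+0 ∷ settled) [] (cong suc (trans (length-replicates g r +0 +1) (+-comm g r))) +1)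
    ¬amg : ∀ c → c Fits (k , −1 ∷ +0 ∷ replicate g +0 ++ replicate (suc r) +1) → ¬ IsAMG c
    ¬amg c fits = ¬IsAMG-crossing c k 0 (2 + g) (Fits-−1<M {m} {+0 ∷ replicate g +0 ++ replicate (suc r) +1} {c} fits)
      (M<Fits-+1 {k} {−1 ∷ +0 ∷ replicate g +0 ++ replicate (suc r) +1} {c} (2 + g) fits
         (offsetAt-++-index (replicate g +0) (replicate (suc r) +1) 0 (length-replicate g)))
    amg : ∀ c → c Fits (k , +0 ∷ settled ++ [ +0 ]) → IsAMG c
    amg c = IsAMG-leading-zero {w = settled ++ [ +0 ]} {c} (++⁺ (All-zeros-ones g r) (+0 ∷ []))
              (≤-trans (≤-reflexive (trans (length-∷ʳ settled +0) (cong suc (trans (length-replicates g r +0 +1) (+-comm g r)))))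
                       (n≤1+n m))
    mass≡ : mass (initial (replicate (T m) +1 ++ replicate (suc r) +2 ++ replicate g +1)) ≡ T k + r
    mass≡ = trans (mass-initial-replicate-++ (T m) +1 _)
            (trans (cong (T m * 1 +_) (mass-initial-replicate-++ (suc r) +2 _))
            (trans (cong (λ y → T m * 1 + (suc r * 2 + y)) (mass-initial-replicate g +1)) (arith-mass (T m) r g)))

-- The third family

minus-pass : ∀ {m} u C → All Binary u → length (u ++ +2 ∷ C) ≡ m →
             (suc m , −1 ∷ (u ++ +2 ∷ C) ++ [ +0 ]) ⟶⟨ 1 + length u ⟩ (suc m , +2 ∷ C ++ −1 ∷ +0 ∷ u)
minus-pass u C bin len =
  absorb (u ++ +2 ∷ C) len
  ⨾ recast (trans (cong (λ w → u ++ +2 ∷ w) (++-assoc C [ −1 ] [ +0 ])) (sym (++-assoc u (+2 ∷ C) (−1 ∷ [ +0 ])))) refl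
           (cong (+2 ∷_) (++-assoc C [ −1 ] (+0 ∷ u)))
      (rotate u (+2 ∷ C ++ [ −1 ]) bin +0 (length-++-∷ʳ u (+2 ∷ C) −1 len))

minus-word : ℕ → ℕ → List Offset
minus-word b h = +2 ∷ (replicate b +1 ++ replicate b +0) ++ −1 ∷ replicate (suc h) +0 ++ replicate h +1

minus-round : ∀ {q} b h → suc b + h ≡ q →
              (suc (suc (q + q)) , minus-word (suc b) h) ⟶⟨ 4 + (q + q) ⟩ (suc (suc (q + q)) , minus-word b (suc h))
minus-round b h refl =
  recast refl time refl
    (surge-split-rotate u₁ (−1 ∷ B) (++⁺ (replicate⁺ b +1) (replicate⁺ (suc b) +0)) len₁
       (there +1 (Last-++ u₁ (there −1 (All⇒Last (++⁺ (replicate⁺ (suc h) +0) (replicate⁺ h +1))))))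
     ⨾ recast (cong (−1 ∷_) absorbed) refl refl (minus-pass u₂ C (All-zeros-ones (suc h) (suc h)) len₂))
  where
    open ≡-Reasoning
    arith₁ : ∀ b h → b + suc b + suc (suc h + h) ≡ suc (suc b + h + (suc b + h))
    arith₁ = solve-∀
    arith₂ : ∀ b h → suc h + suc h + suc (b + b) ≡ suc (suc b + h + (suc b + h))
    arith₂ = solve-∀
    arith₃ : ∀ b h → 2 + (b + suc b) + (1 + (suc h + suc h)) ≡ 4 + (suc b + h + (suc b + h))
    arith₃ = solve-∀
    u₁ = replicate b +1 ++ replicate (suc b) +0
    B  = replicate (suc h) +0 ++ replicate h +1
    C  = replicate b +1 ++ replicate b +0
    u₂ = replicate (suc h) +0 ++ replicate (suc h) +1
    absorbed : (u₂ ++ +2 ∷ C) ++ [ +0 ] ≡ B ++ +1 ∷ +2 ∷ u₁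
    absorbed = begin
      (u₂ ++ +2 ∷ C) ++ [ +0 ]  ≡⟨ ++-assoc u₂ (+2 ∷ C) [ +0 ] ⟩
      u₂ ++ +2 ∷ C ++ [ +0 ]    ≡⟨ cong (λ w → u₂ ++ +2 ∷ w) (trans (++-assoc (replicate b +1) (replicate b +0) [ +0 ])
                                                                   (cong (replicate b +1 ++_) (replicate-∷ʳ b +0))) ⟩
      u₂ ++ +2 ∷ u₁             ≡⟨ cong (_++ +2 ∷ u₁) (trans (++-assoc (replicate (suc h) +0) (replicate h +1) [ +1 ])
                                                            (cong (replicate (suc h) +0 ++_) (replicate-∷ʳ h +1))) ⟨
      (B ++ [ +1 ]) ++ +2 ∷ u₁  ≡⟨ ++-assoc B [ +1 ] (+2 ∷ u₁) ⟩
      B ++ +1 ∷ +2 ∷ u₁         ∎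
    len₁ : length (u₁ ++ −1 ∷ B) ≡ _
    len₁ = trans (length-++ u₁) (trans (cong₂ (λ x y → x + suc y) (length-replicates b (suc b) +1 +0) (length-replicates (suc h) h +0 +1))
                                       (arith₁ b h))
    len₂ : length (u₂ ++ +2 ∷ C) ≡ _
    len₂ = trans (length-++ u₂) (trans (cong₂ (λ x y → x + suc y) (length-replicates (suc h) (suc h) +0 +1) (length-replicates b b +1 +0))
                                       (arith₂ b h))
    time : 2 + length u₁ + (1 + length u₂) ≡ 4 + (suc b + h + (suc b + h))
    time = trans (cong₂ (λ x y → 2 + x + (1 + y)) (length-replicates b (suc b) +1 +0) (length-replicates (suc h) (suc h) +0 +1))
                 (arith₃ b h)

minus-rounds : ∀ {q} b h → b + h ≡ q →
               (suc (suc (q + q)) , minus-word b h) ⟶⟨ b * (4 + (q + q)) ⟩ (suc (suc (q + q)) , minus-word 0 (b + h))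
minus-rounds zero    h _  = same-heights λ _ → refl
minus-rounds (suc b) h eq =
  minus-round b h eq
  ⨾ recast refl refl (cong (minus-word 0) (+-suc b h)) (minus-rounds b (suc h) (trans (+-suc b h) eq))

ℓ₃-orbit : ∀ q →
           (0 , replicate (T (suc (q + q))) +1 ++ +3 ∷ replicate q +2 ++ replicate q +1)
             ⟶⟨ T (suc (q + q)) + (q * (4 + (q + q)) + 1) ⟩
           (suc (suc (q + q)) , −1 ∷ (replicate (suc q) +0 ++ replicate q +1) ++ +1 ∷ [ +1 ])
ℓ₃-orbit q =
  build-staircase m tail tail-nonneg
  ⨾ lower-base tail (cong suc (length-replicates q q +2 +1)) tail-nonneg
  ⨾ recast refl refl lowered (pad (map lower tail ++ [ −1 ]) 1)
  ⨾ recast refl refl (cong (minus-word 0) (+-identityʳ q)) (minus-rounds q 0 (+-identityʳ q))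
  ⨾ surge (−1 ∷ replicate (suc q) +0 ++ replicate q +1) (cong suc (length-replicates (suc q) q +0 +1))
          (there −1 (All⇒Last (++⁺ (replicate⁺ (suc q) +0) (replicate⁺ q +1))))
  where
    m = suc (q + q)
    tail = +3 ∷ replicate q +2 ++ replicate q +1
    tail-nonneg : All NonNegative tail
    tail-nonneg = +3 ∷ ++⁺ (replicate⁺ q +2) (replicate⁺ q +1)
    lowered : (map lower tail ++ [ −1 ]) ++ replicate 1 +0 ≡ minus-word q 0
    lowered = begin
      (+2 ∷ map lower (replicate q +2 ++ replicate q +1) ++ [ −1 ]) ++ [ +0 ]
        ≡⟨ cong (λ w → (+2 ∷ w ++ [ −1 ]) ++ [ +0 ]) (trans (map-++ lower (replicate q +2) (replicate q +1))
                                                              (cong₂ _++_ (map-replicate lower q +2) (map-replicate lower q +1))) ⟩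
      (+2 ∷ (replicate q +1 ++ replicate q +0) ++ [ −1 ]) ++ [ +0 ]
        ≡⟨ cong (+2 ∷_) (++-assoc (replicate q +1 ++ replicate q +0) [ −1 ] [ +0 ]) ⟩
      minus-word q 0 ∎
      where open ≡-Reasoning

ℓ₃-witness : ∀ q → DAtLeast (T (2 * suc q) + suc q) (T (2 * suc q) + 2 * suc q * q)
ℓ₃-witness q =
  subst₂ DAtLeast mass≡ (trans (arith-time (T m) q) (cong (λ n → T n + n * q) (sym (arith-k q))))
    (DAtLeast-witness (++⁺ (replicate⁺ (T m) +1) (+3 ∷ ++⁺ (replicate⁺ q +2) (replicate⁺ q +1))) (ℓ₃-orbit q)
       (lower-step rest [ +1 ] len-rest +1) ¬amg amg)
  where
    arith-k : ∀ q → 2 * suc q ≡ suc (suc (q + q))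
    arith-k = solve-∀
    arith-mass : ∀ x q → x * 1 + (3 + (q * 2 + q * 1)) ≡ x + suc (suc (q + q)) + suc q
    arith-mass = solve-∀
    arith-time : ∀ x q → suc (x + (q * (4 + (q + q)) + 1)) ≡ x + suc (suc (q + q)) + suc (suc (q + q)) * q
    arith-time = solve-∀
    m = suc (q + q)
    k = suc m
    rest = replicate (suc q) +0 ++ replicate q +1
    len-rest : length rest ≡ m
    len-rest = length-replicates (suc q) q +0 +1
    ¬amg : ∀ c → c Fits (k , −1 ∷ rest ++ +1 ∷ [ +1 ]) → ¬ IsAMG c
    ¬amg c fits = ¬IsAMG-crossing c k 0 (suc k) (Fits-−1<M {m} {rest ++ +1 ∷ [ +1 ]} {c} fits)
      (M<Fits-+1 {k} {−1 ∷ rest ++ +1 ∷ [ +1 ]} {c} (suc k) fits (offsetAt-++-index rest (+1 ∷ [ +1 ]) 1 len-rest))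
    amg : ∀ c → c Fits (k , rest ++ +0 ∷ [ +1 ]) → IsAMG c
    amg c = IsAMG-leading-zero {w = (replicate q +0 ++ replicate q +1) ++ +0 ∷ [ +1 ]} {c}
              (++⁺ (All-zeros-ones q q) (+0 ∷ +1 ∷ []))
              (≤-reflexive (trans (length-++ (replicate q +0 ++ replicate q +1))
                                  (trans (cong (_+ 2) (length-replicates q q +0 +1)) (+-comm (q + q) 2))))
    mass≡ : mass (initial (replicate (T m) +1 ++ +3 ∷ replicate q +2 ++ replicate q +1)) ≡ T (2 * suc q) + suc q
    mass≡ = trans (mass-initial-replicate-++ (T m) +1 _)
            (trans (cong (λ y → T m * 1 + (3 + y)) (mass-initial-replicate-++ q +2 _))
            (trans (cong (λ y → T m * 1 + (3 + (q * 2 + y))) (mass-initial-replicate q +1))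
            (trans (arith-mass (T m) q) (cong (λ n → T n + suc q) (sym (arith-k q))))))

D≥ℓ₁ : ∀ k r → 2 ≤ r → r ≤ k + 1 → DAtLeast (T k + r) (T k + (r ∸ 2) * (k + 2) + 2)
D≥ℓ₁ k r 2≤r r≤k+1 with m≤n⇒∃[o]m+o≡n 2≤r
... | a , refl with m≤n⇒∃[o]m+o≡n (≤-pred (subst (2 + a ≤_) (+-comm k 1) r≤k+1))
...   | z , refl = ℓ₁-witness a z

∸-cancel : ∀ r g → 2 + (r + g) ∸ r ∸ 2 ≡ g
∸-cancel zero    g = refl
∸-cancel (suc r) g = ∸-cancel r g

D≥ℓ₂ : ∀ k r → 2 ≤ k → r ≤ k ∸ 2 → DAtLeast (T k + r) (T k + k * (k ∸ r ∸ 2))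
D≥ℓ₂ k r 2≤k r≤k∸2 with m≤n⇒∃[o]m+o≡n 2≤k
... | j , refl with m≤n⇒∃[o]m+o≡n r≤k∸2
...   | g , refl = subst (λ x → DAtLeast (T (2 + (r + g)) + r) (T (2 + (r + g)) + (2 + (r + g)) * x))
                         (sym (∸-cancel r g)) (ℓ₂-witness r g)

D≥ℓ₃ : ∀ r → 1 ≤ r → DAtLeast (T (2 * r) + r) (T (2 * r) + 2 * r * (r ∸ 1))
D≥ℓ₃ r 1≤r with m≤n⇒∃[o]m+o≡n 1≤r
... | q , refl = ℓ₃-witness q

mainTheorem3 : (n : ℕ) → 1 ≤ n →
    ((k r : ℕ) → 1 ≤ k → 2 ≤ r → r ≤ k + 1 → n ≡ T k + r →
       DAtLeast n (T k + (r ∸ 2) * (k + 2) + 2))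
    × ((k r : ℕ) → 2 ≤ k → r ≤ k ∸ 2 → n ≡ T k + r →
       DAtLeast n (T k + k * (k ∸ r ∸ 2)))
    × ((r : ℕ) → 1 ≤ r → n ≡ T (2 * r) + r →
       DAtLeast n (T (2 * r) + 2 * r * (r ∸ 1)))
mainTheorem3 n _ =
  (λ k r _ 2≤r r≤k+1 n≡ → subst (λ n → DAtLeast n _) (sym n≡) (D≥ℓ₁ k r 2≤r r≤k+1)) ,
  (λ k r 2≤k r≤k∸2 n≡ → subst (λ n → DAtLeast n _) (sym n≡) (D≥ℓ₂ k r 2≤k r≤k∸2)) ,
  (λ r 1≤r n≡ → subst (λ n → DAtLeast n _) (sym n≡) (D≥ℓ₃ r 1≤r))
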